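{- Consider colored partitions in which each part $k$ comes in $k$ colors: a such partition of $n$ is a finite multiset of colored parts $r_c$ with $r\ge1$ and $c\in\{1,\dots,r\}$, whose sizes (counted with multiplicity) sum to $n$. Let $F_k(n)$ be the total number of parts of size $k$ (of any color, with multiplicity) appearing in all such partitions of $n$. For such a partition $\pi$, let $g_k(\pi)$ be the number of distinct colored parts $r_c$ occurring at least $k$ times in $\pi$, and let $G_k(n)=\sum_\pi g_k(\pi)$ over all such partitions $\pi$ of $n$, with $G_k(m)=0$ for $m\le 0$. Then for all $n=1,2,\dots$ and $k=1,2,\dots,n$, $$F_k(n)=k\big(G_k(n)-G_k(n-k)\big).$$
   Context: The generating function for the number of such partitions is $\prod_{k\ge1}(1-q^k)^{ -k}$. -}

module Defs where

open import Data.Nat using (ℕ; zero; suc; _+_; _*_; _≤_; _<_; _≤?_; _≟_)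
open import Data.Product using (Σ; _×_; _,_; proj₁; proj₂)
open import Data.Product.Properties using (≡-dec)
open import Data.Sum using (_⊎_)
open import Data.List using (List; []; _∷_; map; length; filter; deduplicate)
open import Data.Nat.ListAction using (sum)
open import Data.List.Relation.Unary.All using (All)
open import Data.List.Relation.Unary.Linked using (Linked)
open import Relation.Binary.PropositionalEquality using (_≡_)
open import Relation.Nullary using (Dec)

ColoredPart : Set
ColoredPart = ℕ × ℕ

size : ColoredPart → ℕ
size = proj₁

color : ColoredPart → ℕ
color = proj₂

ValidPart : ColoredPart → Set
ValidPart (r , c) = 1 ≤ c × c ≤ r

_≟ᶜ_ : (p q : ColoredPart) → Dec (p ≡ q)
_≟ᶜ_ = ≡-dec _≟_ _≟_

_≽_ : ColoredPart → ColoredPart → Set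
(r , c) ≽ (s , d) = s < r ⊎ (s ≡ r × d ≤ c)

-- A colored partition of n: a finite multiset of colored parts, represented
-- canonically as a lexicographically non-increasing list, whose sizes sum to n.
Partition : ℕ → Set
Partition n = Σ (List ColoredPart) λ ps →
  All ValidPart ps × Linked _≽_ ps × sum (map size ps) ≡ n

parts : ∀ {n} → Partition n → List ColoredPart
parts = proj₁

f : ℕ → ∀ {n} → Partition n → ℕ
f k π = length (filter (λ p → size p ≟ k) (parts π))

g : ℕ → ∀ {n} → Partition n → ℕ
g k π = length (filter (λ p → k ≤? length (filter (λ q → q ≟ᶜ p) (parts π)))
                       (deduplicate _≟ᶜ_ (parts π)))

total : ∀ {n} → (Partition n → ℕ) → List (Partition n) → ℕ
total h L = sum (map h L)

-- Let A_m(p, t) be the number of partitions of m in which the colored part p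
-- occurs at least t times. Replacing t copies of p by t' copies of p' is a
-- bijection from the partitions of m counted by A_m(p, t) onto those of m'
-- counted by A_m'(p', t'), whenever m + t'|p'| = m' + t|p|. Counting parts
-- by their multiplicity and exchanging j copies of k_c for k copies of j_j gives
--   F_k(n) = Σ_{c ≤ k} Σ_{j ≤ n} A_n(k_c, j) = k Σ_{j ≤ n} A_n(j_j, k),
-- while G_k(n) = Σ_p A_n(p, k) and, exchanging k copies of r_c for k copies
-- of (r+1)_c, G_k(n-k) = Σ_p A_n((r+1)_c, k), both sums over the colored parts
-- p = r_c with r ≤ n. The parts of size at most n that are not of the form
-- (r+1)_c are exactly the j_j, and A_n vanishes on parts of size n+1, so
-- G_k(n) - G_k(n-k) = Σ_{j ≤ n} A_n(j_j, k).

module Submission where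

open import Defs
open import Data.Nat using (ℕ; zero; suc; _+_; _*_; _∸_; _≤_; _<_; _≤?_; _<?_; _≟_; z≤n; s≤s)
open import Data.Nat.Properties
open import Data.Nat.ListAction using (sum)
open import Data.Nat.ListAction.Properties using (sum-++; sum-↭)
open import Data.Nat.Tactic.RingSolver using (solve-∀)
open import Data.Product using (∃-syntax; _×_; _,_; proj₁; proj₂)
open import Data.Sum using (inj₁; inj₂)
open import Data.List using (List; []; _∷_; _++_; map; concatMap; length; filter; replicate; deduplicate; applyDownFrom)
open import Data.List.Properties
  using (map-∘; map-++; length-map; length-applyDownFrom; length-removeAt′;
         filter-all; filter-accept; filter-reject; filter-none)
open import Data.List.Membership.Propositional using (_∈_)
open import Data.List.Membership.Propositional.Properties
  using (∈-filter⁺; ∈-filter⁻; ∈-deduplicate⁺; ∈-deduplicate⁻; ∈-map⁺; ∈-map⁻;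
         ∈-applyDownFrom⁺; ∈-applyDownFrom⁻; ∈-++⁺ˡ; ∈-++⁺ʳ; ∈-++⁻)
open import Data.List.Relation.Binary.Subset.Propositional using (_⊆_)
open import Data.List.Relation.Unary.Any using (here; there; _─_)
open import Data.List.Relation.Unary.All using (All; []; _∷_)
import Data.List.Relation.Unary.All as All
import Data.List.Relation.Unary.All.Properties as All
open import Data.List.Relation.Unary.Linked using (Linked)
import Data.List.Relation.Unary.Linked as Linked
open import Data.List.Relation.Unary.Unique.Propositional using (Unique; []; _∷_)
import Data.List.Relation.Unary.Unique.Propositional.Properties as Unique
open import Data.List.Relation.Unary.Unique.DecPropositional.Properties _≟ᶜ_ using (deduplicate-!)
open import Data.List.Relation.Binary.Permutation.Propositional
  using (_↭_; ↭-refl; ↭-sym; ↭-trans; prep; ↭⇒↭ₛ; module PermutationReasoning)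
open import Data.List.Relation.Binary.Permutation.Propositional.Properties
  using (All-resp-↭; ↭-length; filter-↭; shift; drop-∷; ++⁺ˡ; map⁺)
open import Data.List.Relation.Binary.Pointwise using (Pointwise-≡⇒≡)
open import Data.List.Relation.Unary.Sorted.TotalOrder.Properties using (↗↭↗⇒≋)
open import Relation.Binary
  using (DecTotalOrder; Transitive; Antisymmetric; Total; Irrelevant; DecidableEquality; tri<; tri≈; tri>)
open import Relation.Binary.PropositionalEquality
open import Relation.Nullary using (Dec; yes; no; ¬_; _×-dec_; _⊎-dec_)
open import Relation.Unary using (Decidable)
import Relation.Unary as U
open import Data.Empty using (⊥-elim)
open import Function using (_∘_)
open import Level using (0ℓ)

private variable
  A B : Set

-- Finite sums and double counting

∑ : List A → (A → ℕ) → ℕ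
∑ xs h = sum (map h xs)

syntax ∑ xs (λ x → e) = ∑[ x ∈ xs ] e

∑-cong : (xs : List A) {h h′ : A → ℕ} → (∀ {x} → x ∈ xs → h x ≡ h′ x) → ∑ xs h ≡ ∑ xs h′
∑-cong []       _  = refl
∑-cong (x ∷ xs) eq = cong₂ _+_ (eq (here refl)) (∑-cong xs (eq ∘ there))

∑-const : (xs : List A) (c : ℕ) → ∑[ _ ∈ xs ] c ≡ length xs * c
∑-const []       c = refl
∑-const (x ∷ xs) c = cong (c +_) (∑-const xs c)

∑-distrib-+ : (xs : List A) (h h′ : A → ℕ) → ∑[ x ∈ xs ] (h x + h′ x) ≡ ∑ xs h + ∑ xs h′
∑-distrib-+ []       h h′ = refl
∑-distrib-+ (x ∷ xs) h h′ = begin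
  h x + h′ x + ∑[ x ∈ xs ] (h x + h′ x)  ≡⟨ cong (h x + h′ x +_) (∑-distrib-+ xs h h′) ⟩
  h x + h′ x + (∑ xs h + ∑ xs h′)        ≡⟨ +-+-comm (h x) (h′ x) (∑ xs h) (∑ xs h′) ⟩
  h x + ∑ xs h + (h′ x + ∑ xs h′)        ∎
  where
  open ≡-Reasoning
  +-+-comm : ∀ a b c d → a + b + (c + d) ≡ a + c + (b + d)
  +-+-comm = solve-∀

∑-comm : (xs : List A) (ys : List B) (h : A → B → ℕ) →
  ∑[ x ∈ xs ] ∑[ y ∈ ys ] h x y ≡ ∑[ y ∈ ys ] ∑[ x ∈ xs ] h x y
∑-comm []       ys h = sym (trans (∑-const ys 0) (*-zeroʳ (length ys)))
∑-comm (x ∷ xs) ys h = trans (cong (∑ ys (h x) +_) (∑-comm xs ys h))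
                             (sym (∑-distrib-+ ys (h x) (λ y → ∑[ x ∈ xs ] h x y)))

∑-map : (f : A → B) (xs : List A) (h : B → ℕ) → ∑ (map f xs) h ≡ ∑[ x ∈ xs ] h (f x)
∑-map f xs h = cong sum (sym (map-∘ xs))

∑-++ : (xs ys : List A) (h : A → ℕ) → ∑ (xs ++ ys) h ≡ ∑ xs h + ∑ ys h
∑-++ xs ys h = trans (cong sum (map-++ h xs ys)) (sum-++ (map h xs) (map h ys))

∑-replicate-++ : (t : ℕ) (x : A) (xs : List A) (h : A → ℕ) → ∑ (replicate t x ++ xs) h ≡ t * h x + ∑ xs h
∑-replicate-++ zero    x xs h = refl
∑-replicate-++ (suc t) x xs h = trans (cong (h x +_) (∑-replicate-++ t x xs h)) (sym (+-assoc (h x) (t * h x) _))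

∈⇒≤∑ : {x : A} {xs : List A} (h : A → ℕ) → x ∈ xs → h x ≤ ∑ xs h
∈⇒≤∑ h (here refl) = m≤m+n _ _
∈⇒≤∑ {xs = y ∷ _} h (there x∈xs) = ≤-trans (∈⇒≤∑ h x∈xs) (m≤n+m _ (h y))

indicator : {P : Set} → Dec P → ℕ
indicator (yes _) = 1
indicator (no _)  = 0

length-filter≡∑indicator : {P : A → Set} (P? : Decidable P) (xs : List A) →
  length (filter P? xs) ≡ ∑[ x ∈ xs ] indicator (P? x)
length-filter≡∑indicator P? []       = refl
length-filter≡∑indicator P? (x ∷ xs) with P? x
... | yes _ = cong suc (length-filter≡∑indicator P? xs)
... | no  _ = length-filter≡∑indicator P? xs

double-counting : {R : A → B → Set} (R? : ∀ a → Decidable (R a)) (as : List A) (bs : List B) →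
  ∑[ a ∈ as ] length (filter (R? a) bs) ≡ ∑[ b ∈ bs ] length (filter (λ a → R? a b) as)
double-counting R? as bs = begin
  ∑[ a ∈ as ] length (filter (R? a) bs)
    ≡⟨ ∑-cong as (λ _ → length-filter≡∑indicator (R? _) bs) ⟩
  ∑[ a ∈ as ] ∑[ b ∈ bs ] indicator (R? a b)
    ≡⟨ ∑-comm as bs (λ a b → indicator (R? a b)) ⟩
  ∑[ b ∈ bs ] ∑[ a ∈ as ] indicator (R? a b)
    ≡⟨ ∑-cong bs (λ _ → sym (length-filter≡∑indicator (λ a → R? a _) as)) ⟩
  ∑[ b ∈ bs ] length (filter (λ a → R? a b) as) ∎
  where open ≡-Reasoning

∈-─ : {x y : A} {xs : List A} (x∈xs : x ∈ xs) → y ∈ xs → y ≢ x → y ∈ (xs ─ x∈xs)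
∈-─ (here refl) (here refl)  y≢x = ⊥-elim (y≢x refl)
∈-─ (here refl) (there y∈xs) _   = y∈xs
∈-─ (there _)   (here refl)  _   = here refl
∈-─ (there x∈xs) (there y∈xs) y≢x = there (∈-─ x∈xs y∈xs y≢x)

injection⇒length≤ : {xs : List A} {ys : List B} → Unique xs →
  (h : ∀ {x} → x ∈ xs → B) → (∀ {x y} (i : x ∈ xs) (j : y ∈ xs) → h i ≡ h j → x ≡ y) →
  (∀ {x} (i : x ∈ xs) → h i ∈ ys) → length xs ≤ length ys
injection⇒length≤ {xs = []}     _            _ _   _  = z≤n
injection⇒length≤ {xs = x ∷ xs} {ys} (x∉xs ∷ xs!) h inj h∈ = begin
  suc (length xs)          ≤⟨ s≤s (injection⇒length≤ xs! (h ∘ there) (λ i j → inj (there i) (there j)) h∈rest) ⟩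
  suc (length (ys ─ hx∈))  ≡⟨ length-removeAt′ ys _ ⟨
  length ys                ∎
  where
  open ≤-Reasoning
  hx∈ : h (here refl) ∈ ys
  hx∈ = h∈ (here refl)
  h∈rest : ∀ {y} (i : y ∈ xs) → h (there i) ∈ (ys ─ hx∈)
  h∈rest i = ∈-─ hx∈ (h∈ (there i)) (λ e → All.lookup x∉xs i (sym (inj (there i) (here refl) e)))

unique-⊆⇒length≤ : {xs ys : List A} → Unique xs → xs ⊆ ys → length xs ≤ length ys
unique-⊆⇒length≤ xs! xs⊆ys = injection⇒length≤ xs! (λ {x} _ → x) (λ _ _ e → e) xs⊆ys

module _ {P : A → Set} (P? : Decidable P) {Q : B → Set} (Q? : Decidable Q) where

  retraction⇒count≤ : {as : List A} {bs : List B} → Unique as → (∀ b → b ∈ bs) →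
    (φ : ∀ a → P a → B) → (∀ a p → Q (φ a p)) →
    (ψ : ∀ b → Q b → A) → (∀ a p q → ψ (φ a p) q ≡ a) →
    length (filter P? as) ≤ length (filter Q? bs)
  retraction⇒count≤ {as} as! bs-complete φ φ-Q ψ ψ∘φ =
    injection⇒length≤ (Unique.filter⁺ P? as!) h h-injective
      (λ i → ∈-filter⁺ Q? (bs-complete _) (φ-Q _ _))
    where
    h : ∀ {a} → a ∈ filter P? as → B
    h {a} i = φ a (proj₂ (∈-filter⁻ P? {xs = as} i))
    ψ-subst : ∀ {b b′} (e : b ≡ b′) (q : Q b) → ψ b q ≡ ψ b′ (subst Q e q)
    ψ-subst refl q = refl
    h-injective : ∀ {a a′} (i : a ∈ filter P? as) (j : a′ ∈ filter P? as) → h i ≡ h j → a ≡ a′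
    h-injective i j e = trans (sym (ψ∘φ _ _ _)) (trans (ψ-subst e (φ-Q _ _)) (ψ∘φ _ _ _))

module Multiplicity (_≟_ : DecidableEquality A) where

  mult : A → List A → ℕ
  mult x xs = length (filter (_≟ x) xs)

  mult-resp-↭ : {x : A} {xs ys : List A} → xs ↭ ys → mult x xs ≡ mult x ys
  mult-resp-↭ xs↭ys = ↭-length (filter-↭ (_≟ _) xs↭ys)

  mult-replicate-++ : (t : ℕ) (x : A) (xs : List A) → mult x (replicate t x ++ xs) ≡ t + mult x xs
  mult-replicate-++ zero    x xs = refl
  mult-replicate-++ (suc t) x xs =
    trans (cong length (filter-accept (_≟ x) refl)) (cong suc (mult-replicate-++ t x xs))

  mult-pos⇒∈ : {x : A} (xs : List A) → 0 < mult x xs → x ∈ xs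
  mult-pos⇒∈ {x} (y ∷ xs) pos with y ≟ x
  ... | yes refl = here refl
  ... | no  _    = there (mult-pos⇒∈ xs pos)

  mult≤∑ : {x : A} (h : A → ℕ) → 1 ≤ h x → (xs : List A) → mult x xs ≤ ∑ xs h
  mult≤∑     h hx≥1 []       = z≤n
  mult≤∑ {x} h hx≥1 (y ∷ xs) with y ≟ x
  ... | yes refl = +-mono-≤ hx≥1 (mult≤∑ h hx≥1 xs)
  ... | no  _    = ≤-trans (mult≤∑ h hx≥1 xs) (m≤n+m _ (h y))

  unique-∈⇒count≡1 : {x : A} {xs : List A} → Unique xs → x ∈ xs → length (filter (x ≟_) xs) ≡ 1
  unique-∈⇒count≡1 {x} (x∉xs ∷ _) (here refl) =
    cong length (trans (filter-accept (x ≟_) refl) (cong (x ∷_) (filter-none (x ≟_) x∉xs)))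
  unique-∈⇒count≡1 {x} (y∉ys ∷ ys!) (there x∈ys) =
    trans (cong length (filter-reject (x ≟_) (λ x≡y → All.lookup y∉ys x∈ys (sym x≡y))))
          (unique-∈⇒count≡1 ys! x∈ys)

  ≤mult⇒↭replicate-++ : {x : A} (t : ℕ) (xs : List A) → t ≤ mult x xs → ∃[ ys ] xs ↭ replicate t x ++ ys
  ≤mult⇒↭replicate-++     zero    xs       _ = xs , ↭-refl
  ≤mult⇒↭replicate-++ {x} (suc t) (y ∷ xs) 1+t≤mult with y ≟ x
  ... | yes refl = let ys , xs↭ = ≤mult⇒↭replicate-++ t xs (≤-pred 1+t≤mult) in ys , prep y xs↭
  ... | no  _    = let ys , xs↭ = ≤mult⇒↭replicate-++ (suc t) xs 1+t≤mult in
                   y ∷ ys , ↭-trans (prep y xs↭) (↭-sym (shift y (replicate (suc t) x) ys))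

++-cancelˡ-↭ : (zs : List A) {xs ys : List A} → zs ++ xs ↭ zs ++ ys → xs ↭ ys
++-cancelˡ-↭ []       e = e
++-cancelˡ-↭ (z ∷ zs) e = ++-cancelˡ-↭ zs (drop-∷ e)

-- Partitions as sorted lists

_≽?_ : (p q : ColoredPart) → Dec (p ≽ q)
(r , c) ≽? (s , d) = s <? r ⊎-dec (s ≟ r ×-dec d ≤? c)

≽-refl : {p : ColoredPart} → p ≽ p
≽-refl = inj₂ (refl , ≤-refl)

≽-trans : Transitive _≽_
≽-trans (inj₁ s<r)        (inj₁ t<s)        = inj₁ (<-trans t<s s<r)
≽-trans (inj₁ s<r)        (inj₂ (refl , _)) = inj₁ s<r
≽-trans (inj₂ (refl , _)) (inj₁ t<s)        = inj₁ t<s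
≽-trans (inj₂ (refl , d≤c)) (inj₂ (refl , e≤d)) = inj₂ (refl , ≤-trans e≤d d≤c)

≽-antisym : Antisymmetric _≡_ _≽_
≽-antisym (inj₁ s<r)        (inj₁ r<s)        = ⊥-elim (<-asym s<r r<s)
≽-antisym (inj₁ s<r)        (inj₂ (refl , _)) = ⊥-elim (<-irrefl refl s<r)
≽-antisym (inj₂ (refl , _)) (inj₁ r<s)        = ⊥-elim (<-irrefl refl r<s)
≽-antisym (inj₂ (refl , d≤c)) (inj₂ (_ , c≤d)) = cong (_ ,_) (≤-antisym c≤d d≤c)

≽-total : Total _≽_
≽-total (r , c) (s , d) with <-cmp r s
... | tri< r<s _    _   = inj₂ (inj₁ r<s)
... | tri> _    _   s<r = inj₁ (inj₁ s<r)
... | tri≈ _    refl _  with ≤-total c d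
...   | inj₁ c≤d = inj₂ (inj₂ (refl , c≤d))
...   | inj₂ d≤c = inj₁ (inj₂ (refl , d≤c))

≽-irrelevant : Irrelevant _≽_
≽-irrelevant (inj₁ s<r)      (inj₁ s<r′)       = cong inj₁ (<-irrelevant s<r s<r′)
≽-irrelevant (inj₁ s<r)      (inj₂ (refl , _)) = ⊥-elim (<-irrefl refl s<r)
≽-irrelevant (inj₂ (refl , _)) (inj₁ s<r)      = ⊥-elim (<-irrefl refl s<r)
≽-irrelevant (inj₂ (e , d≤c)) (inj₂ (e′ , d≤c′)) =
  cong₂ (λ e d≤c → inj₂ (e , d≤c)) (≡-irrelevant e e′) (≤-irrelevant d≤c d≤c′)

-- Its ≤ is _≽_, so that sorting for this order yields the non-increasing lists representing partitions.
≽-decTotalOrder : DecTotalOrder 0ℓ 0ℓ 0ℓ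
≽-decTotalOrder = record
  { isDecTotalOrder = record
    { isTotalOrder = record
      { isPartialOrder = record
        { isPreorder = record
          { isEquivalence = isEquivalence
          ; reflexive     = λ { refl → ≽-refl }
          ; trans         = ≽-trans
          }
        ; antisym = ≽-antisym
        }
      ; total = ≽-total
      }
    ; _≟_  = _≟ᶜ_
    ; _≤?_ = _≽?_
    }
  }

open DecTotalOrder ≽-decTotalOrder using (totalOrder)
open import Data.List.Sort ≽-decTotalOrder using (sort; sort-↭; sort-↗)
open Multiplicity _≟ᶜ_

sorted-↭⇒≡ : {xs ys : List ColoredPart} → Linked _≽_ xs → Linked _≽_ ys → xs ↭ ys → xs ≡ ys
sorted-↭⇒≡ xs↗ ys↗ xs↭ys = Pointwise-≡⇒≡ (↗↭↗⇒≋ totalOrder xs↗ ys↗ (↭⇒↭ₛ xs↭ys))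

validPart-irrelevant : U.Irrelevant ValidPart
validPart-irrelevant (1≤c , c≤r) (1≤c′ , c≤r′) = cong₂ _,_ (≤-irrelevant 1≤c 1≤c′) (≤-irrelevant c≤r c≤r′)

parts-↭⇒≡ : ∀ {m} {π σ : Partition m} → parts π ↭ parts σ → π ≡ σ
parts-↭⇒≡ {π = ps , valid , ps↗ , ∑ps} {σ = qs , valid′ , qs↗ , ∑qs} ps↭qs
  with refl ← sorted-↭⇒≡ ps↗ qs↗ ps↭qs
  rewrite All.irrelevant validPart-irrelevant valid valid′
        | Linked.irrelevant ≽-irrelevant ps↗ qs↗
        | ≡-irrelevant ∑ps ∑qs
  = refl

valid-parts : ∀ {m} (π : Partition m) → All ValidPart (parts π)
valid-parts (_ , valid , _ , _) = valid

∑-parts : ∀ {m} (π : Partition m) → ∑ (parts π) size ≡ m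
∑-parts (_ , _ , _ , ∑ps) = ∑ps

fromMultiset : ∀ {m} (xs : List ColoredPart) → All ValidPart xs → ∑ xs size ≡ m → Partition m
fromMultiset xs valid ∑xs =
  sort xs , All-resp-↭ (↭-sym (sort-↭ xs)) valid , sort-↗ xs , trans (sum-↭ (map⁺ size (sort-↭ xs))) ∑xs

-- Exchanging parts

module Exchange {m m′ : ℕ} (p : ColoredPart) (t : ℕ) (p′ : ColoredPart) (t′ : ℕ)
                (valid′ : ValidPart p′) (balance : m + t′ * size p′ ≡ m′ + t * size p)
                (π : Partition m) (t≤mult : t ≤ mult p (parts π)) where

  rest : List ColoredPart
  rest = proj₁ (≤mult⇒↭replicate-++ t (parts π) t≤mult)

  parts↭ : parts π ↭ replicate t p ++ rest
  parts↭ = proj₂ (≤mult⇒↭replicate-++ t (parts π) t≤mult)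

  private
    valid-rest : All ValidPart rest
    valid-rest = All.++⁻ʳ (replicate t p) (All-resp-↭ parts↭ (valid-parts π))

    ∑-rest : t * size p + ∑ rest size ≡ m
    ∑-rest = begin
      t * size p + ∑ rest size          ≡⟨ ∑-replicate-++ t p rest size ⟨
      ∑ (replicate t p ++ rest) size    ≡⟨ sum-↭ (map⁺ size parts↭) ⟨
      ∑ (parts π) size                  ≡⟨ ∑-parts π ⟩
      m                                 ∎
      where open ≡-Reasoning

    ∑-exchanged : ∑ (replicate t′ p′ ++ rest) size ≡ m′
    ∑-exchanged = +-cancelʳ-≡ (t * size p) _ _ (begin
      ∑ (replicate t′ p′ ++ rest) size + t * size p  ≡⟨ cong (_+ t * size p) (∑-replicate-++ t′ p′ rest size) ⟩
      t′ * size p′ + ∑ rest size + t * size p        ≡⟨ rearrange (t′ * size p′) (∑ rest size) (t * size p) ⟩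
      t * size p + ∑ rest size + t′ * size p′        ≡⟨ cong (_+ t′ * size p′) ∑-rest ⟩
      m + t′ * size p′                               ≡⟨ balance ⟩
      m′ + t * size p                                ∎)
      where
      open ≡-Reasoning
      rearrange : ∀ a b c → a + b + c ≡ c + b + a
      rearrange = solve-∀

  exchange : Partition m′
  exchange = fromMultiset (replicate t′ p′ ++ rest)
                          (All.++⁺ (All.replicate⁺ t′ valid′) valid-rest) ∑-exchanged

  exchange-↭ : parts exchange ↭ replicate t′ p′ ++ rest
  exchange-↭ = sort-↭ _

  t′≤mult-exchange : t′ ≤ mult p′ (parts exchange)
  t′≤mult-exchange = begin
    t′                                  ≤⟨ m≤m+n t′ _ ⟩
    t′ + mult p′ rest                   ≡⟨ mult-replicate-++ t′ p′ rest ⟨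
    mult p′ (replicate t′ p′ ++ rest)   ≡⟨ mult-resp-↭ exchange-↭ ⟨
    mult p′ (parts exchange)            ∎
    where open ≤-Reasoning

open Exchange using (exchange; t′≤mult-exchange)

exchange-exchange : ∀ {m m′} (p : ColoredPart) (t : ℕ) (p′ : ColoredPart) (t′ : ℕ)
  (valid : ValidPart p) (valid′ : ValidPart p′)
  (balance : m + t′ * size p′ ≡ m′ + t * size p) (balance′ : m′ + t * size p ≡ m + t′ * size p′)
  (π : Partition m) (h : t ≤ mult p (parts π))
  (h′ : t′ ≤ mult p′ (parts (exchange p t p′ t′ valid′ balance π h))) →
  exchange p′ t′ p t valid balance′ (exchange p t p′ t′ valid′ balance π h) h′ ≡ π
exchange-exchange p t p′ t′ valid valid′ balance balance′ π h h′ = parts-↭⇒≡ (begin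
  parts (Y.exchange)       ↭⟨ Y.exchange-↭ ⟩
  replicate t p ++ Y.rest  ↭⟨ ++⁺ˡ (replicate t p) rest-↭ ⟩
  replicate t p ++ X.rest  ↭⟨ X.parts↭ ⟨
  parts π                  ∎)
  where
  open PermutationReasoning
  module X = Exchange p t p′ t′ valid′ balance π h
  module Y = Exchange p′ t′ p t valid balance′ X.exchange h′
  rest-↭ : Y.rest ↭ X.rest
  rest-↭ = ++-cancelˡ-↭ (replicate t′ p′) (↭-trans (↭-sym Y.parts↭) X.exchange-↭)

nContaining : ∀ {m} → ℕ → ColoredPart → List (Partition m) → ℕ
nContaining t p L = length (filter (λ π → t ≤? mult p (parts π)) L)

nContaining-exchange : ∀ {m m′} {L : List (Partition m)} {L′ : List (Partition m′)} →
  Unique L → (∀ π → π ∈ L) → Unique L′ → (∀ σ → σ ∈ L′) →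
  (p : ColoredPart) (t : ℕ) (p′ : ColoredPart) (t′ : ℕ) → ValidPart p → ValidPart p′ →
  m + t′ * size p′ ≡ m′ + t * size p → nContaining t p L ≡ nContaining t′ p′ L′
nContaining-exchange L! L-complete L′! L′-complete p t p′ t′ valid valid′ balance = ≤-antisym
  (retraction⇒count≤ contains? contains′? L! L′-complete
    (exchange p t p′ t′ valid′ balance) (t′≤mult-exchange p t p′ t′ valid′ balance)
    (exchange p′ t′ p t valid (sym balance))
    (exchange-exchange p t p′ t′ valid valid′ balance (sym balance)))
  (retraction⇒count≤ contains′? contains? L′! L-complete
    (exchange p′ t′ p t valid (sym balance)) (t′≤mult-exchange p′ t′ p t valid (sym balance))
    (exchange p t p′ t′ valid′ balance)
    (exchange-exchange p′ t′ p t valid′ valid (sym balance) balance))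
  where
  contains? : Decidable (λ π → t ≤ mult p (parts π))
  contains? π = t ≤? mult p (parts π)
  contains′? : Decidable (λ σ → t′ ≤ mult p′ (parts σ))
  contains′? σ = t′ ≤? mult p′ (parts σ)

[1‥_] : ℕ → List ℕ
[1‥ n ] = applyDownFrom suc n

∈-[1‥]⁻ : {j n : ℕ} → j ∈ [1‥ n ] → 1 ≤ j × j ≤ n
∈-[1‥]⁻ j∈ with _ , i<n , refl ← ∈-applyDownFrom⁻ suc j∈ = s≤s z≤n , i<n

∈-[1‥]⁺ : {j n : ℕ} → 1 ≤ j → j ≤ n → j ∈ [1‥ n ]
∈-[1‥]⁺ {suc i} _ j≤n = ∈-applyDownFrom⁺ suc j≤n

[1‥]-unique : (n : ℕ) → Unique [1‥ n ]
[1‥]-unique n = Unique.applyDownFrom⁺₁ suc n (λ j<i _ → >⇒≢ (s≤s j<i))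

length-filter-≤-[1‥] : {m : ℕ} (N : ℕ) → m ≤ N → length (filter (_≤? m) [1‥ N ]) ≡ m
length-filter-≤-[1‥]         zero    z≤n    = refl
length-filter-≤-[1‥] {m} (suc N) m≤1+N with suc N ≤? m
... | yes 1+N≤m = begin
  length (filter (_≤? m) [1‥ suc N ])   ≡⟨ cong length (filter-accept (_≤? m) 1+N≤m) ⟩
  suc (length (filter (_≤? m) [1‥ N ])) ≡⟨ cong (suc ∘ length) (filter-all (_≤? m) all≤m) ⟩
  suc (length [1‥ N ])                  ≡⟨ cong suc (length-applyDownFrom suc N) ⟩
  suc N                                 ≡⟨ ≤-antisym 1+N≤m m≤1+N ⟩
  m                                     ∎
  where
  open ≡-Reasoning
  all≤m : All (_≤ m) [1‥ N ]
  all≤m = All.tabulate (λ j∈ → ≤-trans (proj₂ (∈-[1‥]⁻ j∈)) (≤-trans (n≤1+n N) 1+N≤m))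
... | no  1+N≰m =
  trans (cong length (filter-reject (_≤? m) 1+N≰m)) (length-filter-≤-[1‥] N (≤-pred (≰⇒> 1+N≰m)))

partsOfSize : ℕ → List ColoredPart
partsOfSize r = map (r ,_) [1‥ r ]

∈-partsOfSize⁻ : {q : ColoredPart} {r : ℕ} → q ∈ partsOfSize r → ValidPart q × size q ≡ r
∈-partsOfSize⁻ q∈ with _ , c∈ , refl ← ∈-map⁻ _ q∈ = ∈-[1‥]⁻ c∈ , refl

∈-partsOfSize⁺ : {q : ColoredPart} → ValidPart q → q ∈ partsOfSize (size q)
∈-partsOfSize⁺ {r , c} (1≤c , c≤r) = ∈-map⁺ (r ,_) (∈-[1‥]⁺ 1≤c c≤r)

partsOfSize-unique : (r : ℕ) → Unique (partsOfSize r)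
partsOfSize-unique r = Unique.map⁺ (cong proj₂) ([1‥]-unique r)

length-partsOfSize : (r : ℕ) → length (partsOfSize r) ≡ r
length-partsOfSize r = trans (length-map (r ,_) [1‥ r ]) (length-applyDownFrom suc r)

partsOfSize≤ : ℕ → List ColoredPart
partsOfSize≤ n = concatMap partsOfSize [1‥ n ]

∈-partsOfSize≤⁻ : {q : ColoredPart} (n : ℕ) → q ∈ partsOfSize≤ n → ValidPart q × size q ≤ n
∈-partsOfSize≤⁻ (suc n) q∈ with ∈-++⁻ (partsOfSize (suc n)) q∈
... | inj₁ q∈row  = let valid , size≡ = ∈-partsOfSize⁻ q∈row in valid , ≤-reflexive size≡
... | inj₂ q∈rest = let valid , size≤n = ∈-partsOfSize≤⁻ n q∈rest in valid , m≤n⇒m≤1+n size≤n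

∈-partsOfSize≤⁺ : {q : ColoredPart} (n : ℕ) → ValidPart q → size q ≤ n → q ∈ partsOfSize≤ n
∈-partsOfSize≤⁺ zero    (1≤c , c≤r) z≤n with () ← ≤-trans 1≤c c≤r
∈-partsOfSize≤⁺ {q} (suc n) valid size≤1+n with size q ≟ suc n
... | yes refl   = ∈-++⁺ˡ (∈-partsOfSize⁺ valid)
... | no  size≢  = ∈-++⁺ʳ (partsOfSize (suc n)) (∈-partsOfSize≤⁺ n valid (≤-pred (≤∧≢⇒< size≤1+n size≢)))

partsOfSize≤-unique : (n : ℕ) → Unique (partsOfSize≤ n)
partsOfSize≤-unique zero    = []
partsOfSize≤-unique (suc n) = Unique.++⁺ (partsOfSize-unique (suc n)) (partsOfSize≤-unique n) disjoint
  where
  disjoint : ∀ {q} → ¬ (q ∈ partsOfSize (suc n) × q ∈ partsOfSize≤ n)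
  disjoint (q∈row , q∈rest) with _ , refl ← ∈-partsOfSize⁻ q∈row = 1+n≰n (proj₂ (∈-partsOfSize≤⁻ n q∈rest))

enlarge : ColoredPart → ColoredPart
enlarge (r , c) = suc r , c

∑-partsOfSize-suc : (h : ColoredPart → ℕ) (r : ℕ) →
  ∑ (partsOfSize (suc r)) h ≡ h (suc r , suc r) + ∑[ q ∈ partsOfSize r ] h (enlarge q)
∑-partsOfSize-suc h r =
  cong (h (suc r , suc r) +_) (trans (∑-map (suc r ,_) [1‥ r ] h) (sym (∑-map (r ,_) [1‥ r ] (h ∘ enlarge))))

∑-partsOfSize≤-enlarge : (h : ColoredPart → ℕ) (n : ℕ) →
  ∑ (partsOfSize≤ n) h + ∑[ q ∈ partsOfSize n ] h (enlarge q)
    ≡ ∑[ q ∈ partsOfSize≤ n ] h (enlarge q) + ∑[ j ∈ [1‥ n ] ] h (j , j)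
∑-partsOfSize≤-enlarge h zero    = refl
∑-partsOfSize≤-enlarge h (suc n) = begin
  ∑ (S ++ P) h + ∑ S h′                     ≡⟨ cong (_+ ∑ S h′) (∑-++ S P h) ⟩
  ∑ S h + ∑ P h + ∑ S h′                    ≡⟨ cong (λ x → x + ∑ P h + ∑ S h′) (∑-partsOfSize-suc h n) ⟩
  diagonal + ∑ (partsOfSize n) h′ + ∑ P h + ∑ S h′
    ≡⟨ rearrange₁ diagonal (∑ (partsOfSize n) h′) (∑ P h) (∑ S h′) ⟩
  ∑ S h′ + diagonal + (∑ P h + ∑ (partsOfSize n) h′)
    ≡⟨ cong (∑ S h′ + diagonal +_) (∑-partsOfSize≤-enlarge h n) ⟩
  ∑ S h′ + diagonal + (∑ P h′ + D)          ≡⟨ rearrange₂ (∑ S h′) diagonal (∑ P h′) D ⟩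
  ∑ S h′ + ∑ P h′ + (diagonal + D)          ≡⟨ cong (_+ (diagonal + D)) (∑-++ S P h′) ⟨
  ∑ (S ++ P) h′ + (diagonal + D)            ∎
  where
  open ≡-Reasoning
  S P : List ColoredPart
  S = partsOfSize (suc n)
  P = partsOfSize≤ n
  h′ : ColoredPart → ℕ
  h′ = h ∘ enlarge
  diagonal D : ℕ
  diagonal = h (suc n , suc n)
  D = ∑[ j ∈ [1‥ n ] ] h (j , j)
  rearrange₁ : ∀ a b c d → a + b + c + d ≡ d + a + (c + b)
  rearrange₁ = solve-∀
  rearrange₂ : ∀ a b c d → a + b + (c + d) ≡ a + c + (b + d)
  rearrange₂ = solve-∀

-- The statistics F and G

count-partsOfSize : {x : ColoredPart} (k : ℕ) → ValidPart x →
  length (filter (x ≟ᶜ_) (partsOfSize k)) ≡ indicator (size x ≟ k)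
count-partsOfSize {x} k valid with size x ≟ k
... | yes refl    = unique-∈⇒count≡1 (partsOfSize-unique (size x)) (∈-partsOfSize⁺ valid)
... | no  size≢k = cong length (filter-none (x ≟ᶜ_) (All.tabulate λ q∈ x≡q →
                     size≢k (trans (cong size x≡q) (proj₂ (∈-partsOfSize⁻ q∈)))))

f≡∑mult : (k : ℕ) {m : ℕ} (π : Partition m) → f k π ≡ ∑[ q ∈ partsOfSize k ] mult q (parts π)
f≡∑mult k π = begin
  f k π
    ≡⟨ length-filter≡∑indicator (λ x → size x ≟ k) (parts π) ⟩
  ∑[ x ∈ parts π ] indicator (size x ≟ k)
    ≡⟨ ∑-cong (parts π) (λ x∈ → count-partsOfSize k (All.lookup (valid-parts π) x∈)) ⟨
  ∑[ x ∈ parts π ] length (filter (x ≟ᶜ_) (partsOfSize k))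
    ≡⟨ double-counting (λ q x → x ≟ᶜ q) (partsOfSize k) (parts π) ⟨
  ∑[ q ∈ partsOfSize k ] mult q (parts π) ∎
  where open ≡-Reasoning

∑mult≡∑nContaining : ∀ {n} (L : List (Partition n)) (q : ColoredPart) → 1 ≤ size q →
  ∑[ π ∈ L ] mult q (parts π) ≡ ∑[ j ∈ [1‥ n ] ] nContaining j q L
∑mult≡∑nContaining {n} L q 1≤size = begin
  ∑[ π ∈ L ] mult q (parts π)
    ≡⟨ ∑-cong L (λ {π} _ → length-filter-≤-[1‥] n (mult≤n π)) ⟨
  ∑[ π ∈ L ] length (filter (_≤? mult q (parts π)) [1‥ n ])
    ≡⟨ double-counting (λ π j → j ≤? mult q (parts π)) L [1‥ n ] ⟩
  ∑[ j ∈ [1‥ n ] ] nContaining j q L ∎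
  where
  open ≡-Reasoning
  mult≤n : (π : Partition n) → mult q (parts π) ≤ n
  mult≤n π = ≤-trans (mult≤∑ size 1≤size (parts π)) (≤-reflexive (∑-parts π))

total-f≡ : ∀ {n} (k : ℕ) {L : List (Partition n)} → Unique L → (∀ π → π ∈ L) →
  total (f k) L ≡ k * ∑[ j ∈ [1‥ n ] ] nContaining k (j , j) L
total-f≡ {n} k {L} L! L-complete = begin
  ∑[ π ∈ L ] f k π
    ≡⟨ ∑-cong L (λ {π} _ → f≡∑mult k π) ⟩
  ∑[ π ∈ L ] ∑[ q ∈ partsOfSize k ] mult q (parts π)
    ≡⟨ ∑-comm L (partsOfSize k) (λ π q → mult q (parts π)) ⟩
  ∑[ q ∈ partsOfSize k ] ∑[ π ∈ L ] mult q (parts π)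
    ≡⟨ ∑-cong (partsOfSize k) (λ q∈ → ∑mult≡∑nContaining L _ (1≤size (proj₁ (∈-partsOfSize⁻ q∈)))) ⟩
  ∑[ q ∈ partsOfSize k ] ∑[ j ∈ [1‥ n ] ] nContaining j q L
    ≡⟨ ∑-cong (partsOfSize k) (λ q∈ → ∑-cong [1‥ n ] (λ j∈ → exchange-for-diagonal q∈ j∈)) ⟩
  ∑[ _ ∈ partsOfSize k ] D
    ≡⟨ ∑-const (partsOfSize k) D ⟩
  length (partsOfSize k) * D
    ≡⟨ cong (_* D) (length-partsOfSize k) ⟩
  k * D ∎
  where
  open ≡-Reasoning
  D : ℕ
  D = ∑[ j ∈ [1‥ n ] ] nContaining k (j , j) L
  1≤size : ∀ {q} → ValidPart q → 1 ≤ size q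
  1≤size (1≤c , c≤r) = ≤-trans 1≤c c≤r
  exchange-for-diagonal : ∀ {q j} → q ∈ partsOfSize k → j ∈ [1‥ n ] → nContaining j q L ≡ nContaining k (j , j) L
  exchange-for-diagonal {q} {j} q∈ j∈ =
    let valid , size≡k = ∈-partsOfSize⁻ q∈ in
    nContaining-exchange L! L-complete L! L-complete q j (j , j) k valid (proj₁ (∈-[1‥]⁻ j∈) , ≤-refl)
      (cong (n +_) (trans (*-comm k j) (cong (j *_) (sym size≡k))))

g≡count : ∀ {m} (k : ℕ) → 1 ≤ k → (n : ℕ) → m ≤ n → (π : Partition m) →
  g k π ≡ length (filter (λ q → k ≤? mult q (parts π)) (partsOfSize≤ n))
g≡count k 1≤k n m≤n π = ≤-antisym
  (unique-⊆⇒length≤ (Unique.filter⁺ k≤mult? (deduplicate-! (parts π))) dedup⊆partsOfSize≤)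
  (unique-⊆⇒length≤ (Unique.filter⁺ k≤mult? (partsOfSize≤-unique n)) partsOfSize≤⊆dedup)
  where
  k≤mult? : Decidable (λ q → k ≤ mult q (parts π))
  k≤mult? q = k ≤? mult q (parts π)
  dedup⊆partsOfSize≤ : filter k≤mult? (deduplicate _≟ᶜ_ (parts π)) ⊆ filter k≤mult? (partsOfSize≤ n)
  dedup⊆partsOfSize≤ q∈ =
    let q∈dedup , k≤mult = ∈-filter⁻ k≤mult? q∈
        q∈parts = ∈-deduplicate⁻ _≟ᶜ_ (parts π) q∈dedup
        size≤n = ≤-trans (∈⇒≤∑ size q∈parts) (≤-trans (≤-reflexive (∑-parts π)) m≤n)
    in ∈-filter⁺ k≤mult? (∈-partsOfSize≤⁺ n (All.lookup (valid-parts π) q∈parts) size≤n) k≤mult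
  partsOfSize≤⊆dedup : filter k≤mult? (partsOfSize≤ n) ⊆ filter k≤mult? (deduplicate _≟ᶜ_ (parts π))
  partsOfSize≤⊆dedup q∈ =
    let _ , k≤mult = ∈-filter⁻ k≤mult? {xs = partsOfSize≤ n} q∈
    in ∈-filter⁺ k≤mult? (∈-deduplicate⁺ _≟ᶜ_ (mult-pos⇒∈ (parts π) (≤-trans 1≤k k≤mult))) k≤mult

total-g≡ : ∀ {m} (k : ℕ) → 1 ≤ k → (n : ℕ) → m ≤ n → (L : List (Partition m)) →
  total (g k) L ≡ ∑[ q ∈ partsOfSize≤ n ] nContaining k q L
total-g≡ k 1≤k n m≤n L =
  trans (∑-cong L (λ {π} _ → g≡count k 1≤k n m≤n π))
        (double-counting (λ π q → k ≤? mult q (parts π)) L (partsOfSize≤ n))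

nContaining-oversized : ∀ {n} (t : ℕ) → 1 ≤ t → (q : ColoredPart) → n < size q →
  (L : List (Partition n)) → nContaining t q L ≡ 0
nContaining-oversized t 1≤t q n<size L =
  cong length (filter-none (λ π → t ≤? mult q (parts π)) {xs = L} (All.tabulate λ {π} _ t≤mult →
    <⇒≱ n<size (≤-trans (∈⇒≤∑ size (mult-pos⇒∈ (parts π) (≤-trans 1≤t t≤mult))) (≤-reflexive (∑-parts π)))))

nContaining-enlarge : ∀ {n k} → k ≤ n → {L : List (Partition n)} {L′ : List (Partition (n ∸ k))} →
  Unique L → (∀ π → π ∈ L) → Unique L′ → (∀ σ → σ ∈ L′) →
  (q : ColoredPart) → ValidPart q → nContaining k q L′ ≡ nContaining k (enlarge q) L
nContaining-enlarge {n} {k} k≤n L! L-complete L′! L′-complete (r , c) valid@(1≤c , c≤r) =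
  nContaining-exchange L′! L′-complete L! L-complete (r , c) k (suc r , c) k valid (1≤c , m≤n⇒m≤1+n c≤r) balance
  where
  open ≡-Reasoning
  balance : n ∸ k + k * suc r ≡ n + k * r
  balance = begin
    n ∸ k + k * suc r      ≡⟨ cong (n ∸ k +_) (*-suc k r) ⟩
    n ∸ k + (k + k * r)    ≡⟨ +-assoc (n ∸ k) k (k * r) ⟨
    n ∸ k + k + k * r      ≡⟨ cong (_+ k * r) (m∸n+n≡m k≤n) ⟩
    n + k * r              ∎

∑-nContaining-partsOfSize≤ : ∀ {n} (k : ℕ) → 1 ≤ k → (L : List (Partition n)) →
  ∑[ q ∈ partsOfSize≤ n ] nContaining k q L
    ≡ ∑[ q ∈ partsOfSize≤ n ] nContaining k (enlarge q) L + ∑[ j ∈ [1‥ n ] ] nContaining k (j , j) L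
∑-nContaining-partsOfSize≤ {n} k 1≤k L = begin
  ∑ (partsOfSize≤ n) h                                         ≡⟨ +-identityʳ _ ⟨
  ∑ (partsOfSize≤ n) h + 0                                     ≡⟨ cong (∑ (partsOfSize≤ n) h +_) top-row-vanishes ⟨
  ∑ (partsOfSize≤ n) h + ∑[ q ∈ partsOfSize n ] h (enlarge q)  ≡⟨ ∑-partsOfSize≤-enlarge h n ⟩
  ∑[ q ∈ partsOfSize≤ n ] h (enlarge q) + ∑[ j ∈ [1‥ n ] ] h (j , j) ∎
  where
  open ≡-Reasoning
  h : ColoredPart → ℕ
  h q = nContaining k q L
  top-row-vanishes : ∑[ q ∈ partsOfSize n ] h (enlarge q) ≡ 0
  top-row-vanishes = begin
    ∑[ q ∈ partsOfSize n ] h (enlarge q)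
      ≡⟨ ∑-cong (partsOfSize n) (λ {q} q∈ → nContaining-oversized k 1≤k (enlarge q)
           (s≤s (≤-reflexive (sym (proj₂ (∈-partsOfSize⁻ q∈))))) L) ⟩
    ∑[ _ ∈ partsOfSize n ] 0  ≡⟨ ∑-const (partsOfSize n) 0 ⟩
    length (partsOfSize n) * 0 ≡⟨ *-zeroʳ (length (partsOfSize n)) ⟩
    0 ∎

theorem6 : (n k : ℕ) → 1 ≤ k → k ≤ n →
    (L : List (Partition n)) → Unique L → (∀ π → π ∈ L) →
    (L' : List (Partition (n ∸ k))) → Unique L' → (∀ π → π ∈ L') →
    total (f k) L + k * total (g k) L' ≡ k * total (g k) L
theorem6 n k 1≤k k≤n L L! L-complete L′ L′! L′-complete = begin
  total (f k) L + k * total (g k) L′  ≡⟨ cong₂ _+_ (total-f≡ k L! L-complete) (cong (k *_) G′≡E) ⟩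
  k * D + k * E                       ≡⟨ *-distribˡ-+ k D E ⟨
  k * (D + E)                         ≡⟨ cong (k *_) (+-comm D E) ⟩
  k * (E + D)                         ≡⟨ cong (k *_) (∑-nContaining-partsOfSize≤ k 1≤k L) ⟨
  k * ∑[ q ∈ partsOfSize≤ n ] nContaining k q L  ≡⟨ cong (k *_) (total-g≡ k 1≤k n ≤-refl L) ⟨
  k * total (g k) L                   ∎
  where
  open ≡-Reasoning
  D E : ℕ
  D = ∑[ j ∈ [1‥ n ] ] nContaining k (j , j) L
  E = ∑[ q ∈ partsOfSize≤ n ] nContaining k (enlarge q) L
  G′≡E : total (g k) L′ ≡ E
  G′≡E = trans (total-g≡ k 1≤k n (m∸n≤m n k) L′)
               (∑-cong (partsOfSize≤ n) (λ {q} q∈ →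
                  nContaining-enlarge k≤n L! L-complete L′! L′-complete q (proj₁ (∈-partsOfSize≤⁻ n q∈))))
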